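{- Let $k\ge1$, let $\boldsymbol\lambda=(\lambda^{(1)},\dots,\lambda^{(k)})$ be a $k$-tuple of partitions into non-negative parts, and let $\boldsymbol\lambda^+$ be the $k$-tuple obtained from $\boldsymbol\lambda$ by adding $m$ to every part of $\lambda^{(m)}$ for each $m\in\{1,\dots,k\}$ (so that $\mathrm{fs}_u(\boldsymbol\lambda)=\mathrm{fs}_u(\boldsymbol\lambda^+)$ for all $u$). Then for all $u\in\mathbb Z$, \[\Lambda(\boldsymbol\lambda^+,\mathrm{fs}_{u-1}(\boldsymbol\lambda^+))=\Lambda(\boldsymbol\lambda,\mathrm{fs}_u(\boldsymbol\lambda)).\]
   Context: A generalised frequency sequence is a sequence $f=(f_i)_{i\in\mathbb Z}$ of non-negative integers with finitely many non-zero terms ($f_i$ = multiplicity of the part $i$). A partition into non-negative parts is a finite (possibly empty) non-increasing sequence of non-negative integers. Frame sequences: for a $k$-tuple $\boldsymbol\lambda=(\lambda^{(1)},\dots,\lambda^{(k)})$ of such partitions, let $\ell_m$ be the number of parts of $\lambda^{(m)}$ and $s_m=\ell_m+\cdots+\ell_k$. For $u\in\mathbb Z$, $\mathrm{fs}_u(\boldsymbol\lambda)$ is the generalised frequency sequence $f$ with $f_{u+2t}=\#\{m: s_m>t\}$ for $0\le t<s_1$ and all other entries $0$ (from index $u$: $s_k$ pairs $(k,0)$, then $s_{k-1}-s_k$ pairs $(k-1,0)$, …, $s_1-s_2$ pairs $(1,0)$). Particle motion: for a generalised frequency sequence $f$ and $u\in\mathbb Z$ such that, with $h=f_u+f_{u+1}$,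 $f_v+f_{v+1}\le h$ for all $v\ge u$, keep a focus $w$ (initially $u$) and repeat: if $f_{w+1}+f_{w+2}<h$, replace $(f_w,f_{w+1})$ by $(f_w-1,f_{w+1}+1)$ keeping $w$ (particle motion); otherwise replace $w$ by $w+1$ leaving $f$ unchanged (focus shift). $\mathrm{pm}_u^{(m)}(f)$ is the sequence after exactly $m$ particle motions. The map $\Lambda$: with $\ell=s_1$ and the parts renamed $(\lambda_{\ell-1},\dots,\lambda_0):=(\lambda^{(1)}_1,\dots,\lambda^{(1)}_{\ell_1},\dots,\lambda^{(k)}_1,\dots,\lambda^{(k)}_{\ell_k})$ (each $\lambda^{(m)}$ listed in non-increasing order), $\Lambda(\boldsymbol\lambda,\mathrm{fs}_u(\boldsymbol\lambda))=\big(\mathrm{pm}_u^{(\lambda_0)}\circ\mathrm{pm}_{u+2}^{(\lambda_1)}\circ\cdots\circ\mathrm{pm}_{u+2\ell-2}^{(\lambda_{\ell-1})}\big)(\mathrm{fs}_u(\boldsymbol\lambda))$, rightmost applied first. In the left-hand side of the claim, $\Lambda$ is applied to $\boldsymbol\lambda^+$ with frame index $u-1$, i.e. using $\mathrm{pm}_{u-1+2i}$. -}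

module Defs where

open import Data.Nat as ℕ using (ℕ; zero; suc; _≤_; _<_; _≥_; _<?_)
open import Data.Integer as ℤ using (ℤ; +_; -[1+_])
open import Data.Integer.Properties using () renaming (_≟_ to _≟ℤ_)
open import Data.List using (List; []; _∷_; length; filter; map; concat)
open import Data.List.Relation.Unary.Linked using (Linked)
open import Data.Maybe using (Maybe; just; nothing)
import Data.Maybe as Maybe
open import Data.Vec as Vec using (Vec; []; _∷_; toList)
open import Relation.Nullary using (¬_; yes; no)
open import Relation.Binary.PropositionalEquality using (_≡_)

-- A generalised frequency sequence: f i = multiplicity of the part i (i ∈ ℤ).
-- (Finite support is automatic for all sequences arising below.)
GFS : Set
GFS = ℤ → ℕ

NonIncreasing : List ℕ → Set
NonIncreasing = Linked _≥_

-- s-values: s_m = ℓ_m + ⋯ + ℓ_k for m = 1..k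
suffixLens : ∀ {k} → Vec (List ℕ) k → List ℕ
suffixLens [] = []
suffixLens (x ∷ xs) with suffixLens xs
... | [] = length x ∷ []
... | (s ∷ ss) = (length x ℕ.+ s) ∷ s ∷ ss

countAbove : ℕ → List ℕ → ℕ
countAbove t ss = length (filter (t <?_) ss)

evenHalf : ℕ → Maybe ℕ
evenHalf zero = just zero
evenHalf (suc zero) = nothing
evenHalf (suc (suc n)) = Maybe.map suc (evenHalf n)

-- frame sequence fs_u(λ): f_{u+2t} = #{m : s_m > t}, other entries 0
-- (for t ≥ s_1 the count is 0 automatically)
fs : ∀ {k} → ℤ → Vec (List ℕ) k → GFS
fs u ls i with i ℤ.- u
... | -[1+ _ ] = 0
... | + n with evenHalf n
...   | nothing = 0
...   | just t = countAbove t (suffixLens ls)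

move : GFS → ℤ → GFS
move f w i with i ≟ℤ w
... | yes _ = f w ℕ.∸ 1
... | no _ with i ≟ℤ (w ℤ.+ ℤ.1ℤ)
...   | yes _ = suc (f (w ℤ.+ ℤ.1ℤ))
...   | no _ = f i

-- Run h w m f g : starting with focus w and sequence f, after exactly m
-- particle motions (threshold h) the sequence is g.
data Run (h : ℕ) : ℤ → ℕ → GFS → GFS → Set where
  done   : ∀ {w f} → Run h w 0 f f
  motion : ∀ {w m f g} →
           f (w ℤ.+ ℤ.1ℤ) ℕ.+ f (w ℤ.+ + 2) < h →
           Run h w m (move f w) g → Run h w (suc m) f g
  shift  : ∀ {w m f g} →
           ¬ (f (w ℤ.+ ℤ.1ℤ) ℕ.+ f (w ℤ.+ + 2) < h) →
           Run h (w ℤ.+ ℤ.1ℤ) (suc m) f g → Run h w (suc m) f g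

-- PM u m f g : pm_u^{(m)}(f) is defined (the hypothesis on u holds and the
-- process performs m particle motions) and equals g.
PM : ℤ → ℕ → GFS → GFS → Set
PM u m f g =
  (∀ v → u ℤ.≤ v → f v ℕ.+ f (v ℤ.+ ℤ.1ℤ) ≤ f u ℕ.+ f (u ℤ.+ ℤ.1ℤ)) ×'
  Run (f u ℕ.+ f (u ℤ.+ ℤ.1ℤ)) u m f g
  where
  open import Data.Product using () renaming (_×_ to _×'_)

-- LamRun u (λ_{ℓ-1} ∷ ⋯ ∷ λ_0) f g :
-- g = (pm_u^{(λ_0)} ∘ pm_{u+2}^{(λ_1)} ∘ ⋯ ∘ pm_{u+2ℓ-2}^{(λ_{ℓ-1})})(f)
data LamRun (u : ℤ) : List ℕ → GFS → GFS → Set where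
  nil  : ∀ {f} → LamRun u [] f f
  cons : ∀ {p ps f f' g} →
         PM (u ℤ.+ + (2 ℕ.* length ps)) p f f' →
         LamRun u ps f' g → LamRun u (p ∷ ps) f g

allParts : ∀ {k} → Vec (List ℕ) k → List ℕ
allParts ls = concat (toList ls)

-- LambdaRel u λ g : Λ(λ, fs_u(λ)) is defined and equals g
LambdaRel : ∀ {k} → ℤ → Vec (List ℕ) k → GFS → Set
LambdaRel u ls g = LamRun u (allParts ls) (fs u ls) g

plusFrom : ∀ {k} → ℕ → Vec (List ℕ) k → Vec (List ℕ) k
plusFrom m [] = []
plusFrom m (x ∷ xs) = map (m ℕ.+_) x ∷ plusFrom (suc m) xs

plus : ∀ {k} → Vec (List ℕ) k → Vec (List ℕ) k
plus = plusFrom 1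

{-# OPTIONS --safe #-}
module Submission where

-- Both sides are computed part by part, from λ_{ℓ-1} down to λ_0.  Let
-- c_t = #{m : s_m > t}, the height of the frame at u + 2t; the part λ_t
-- belongs to λ^{(c_t)}, so the corresponding part of λ⁺ is λ_t + c_t.  On the
-- right the λ_t motions start at u + 2t, where c_t particles sit on top of an
-- empty site.  On the left everything is shifted one step down: the first c_t
-- of the λ_t + c_t motions at u - 1 + 2t carry those c_t particles to u + 2t,
-- which reproduces the right-hand sequence from u + 2t on; the focus then
-- shifts to u + 2t and the remaining λ_t motions are literally the right-hand
-- ones.  After λ_0 the two sequences agree from u - 1 on, and below u - 1
-- neither frame has particles.

open import Defs
open import Data.Nat using (ℕ; zero; suc; _+_; _*_; _∸_; _≤_; _<_; _<?_; z≤n; s≤s)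
import Data.Nat.Properties as ℕP
open import Data.Integer as ℤ using (ℤ; +_; -[1+_]; _-_; 1ℤ)
import Data.Integer.Properties as ℤP
open import Data.Integer.Tactic.RingSolver using (solve-∀)
open import Algebra.Properties.AbelianGroup ℤP.+-0-abelianGroup using (∙-cancelʳ)
open import Data.List using (List; []; _∷_; length; map; _++_)
import Data.List.Properties as ListP
open import Data.List.Relation.Binary.Sublist.Propositional using (⊆-refl)
import Data.List.Relation.Binary.Sublist.Propositional.Properties as SublistP
import Data.List.Relation.Binary.Sublist.Heterogeneous.Properties as SublistH
open import Data.Maybe as Maybe using (just; nothing; maybe′)
open import Data.Vec using (Vec; []; _∷_)
open import Data.Vec.Relation.Unary.All using (All)
open import Data.Product using (Σ; _×_; ∃; ∃₂; _,_; proj₂)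
open import Data.Sum using (_⊎_; inj₁; inj₂)
open import Data.Empty using (⊥-elim)
open import Function using (_∘_)
open import Relation.Nullary using (¬_; yes; no)
open import Relation.Binary.PropositionalEquality
  using (_≡_; _≢_; _≗_; refl; sym; trans; cong; cong₂; subst; module ≡-Reasoning)

i<i+1 : ∀ i → i ℤ.< i ℤ.+ 1ℤ
i<i+1 i = ℤP.suc[i]≤j⇒i<j (ℤP.≤-reflexive (ℤP.+-comm 1ℤ i))

i≤i+1 : ∀ i → i ℤ.≤ i ℤ.+ 1ℤ
i≤i+1 i = ℤP.<⇒≤ (i<i+1 i)

i<j⇒i+1≤j : ∀ {i j} → i ℤ.< j → i ℤ.+ 1ℤ ℤ.≤ j
i<j⇒i+1≤j {i} i<j = subst (ℤ._≤ _) (ℤP.+-comm 1ℤ i) (ℤP.i<j⇒suc[i]≤j i<j)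

i≤j⇒j≡i⊎i+1≤j : ∀ {i j} → i ℤ.≤ j → j ≡ i ⊎ i ℤ.+ 1ℤ ℤ.≤ j
i≤j⇒j≡i⊎i+1≤j {i} {j} i≤j with j ℤP.≟ i
... | yes j≡i = inj₁ j≡i
... | no j≢i = inj₂ (i<j⇒i+1≤j (ℤP.≤∧≢⇒< i≤j (j≢i ∘ sym)))

i≤j⇒j≡i+d : ∀ {i j} → i ℤ.≤ j → ∃ λ d → j ≡ i ℤ.+ + d
i≤j⇒j≡i+d {i} {j} i≤j = ℤ.∣ j - i ∣ , (begin
  j                    ≡⟨ j≡i+[j-i] i j ⟩
  i ℤ.+ (j - i)        ≡⟨ cong (λ x → i ℤ.+ x) (ℤP.0≤i⇒+∣i∣≡i (ℤP.i≤j⇒0≤j-i i≤j)) ⟨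
  i ℤ.+ + ℤ.∣ j - i ∣  ∎)
  where
  open ≡-Reasoning
  j≡i+[j-i] : ∀ i j → j ≡ i ℤ.+ (j - i)
  j≡i+[j-i] = solve-∀

extendFrom : ∀ {P : ℤ → Set} {w} → P w → (∀ v → w ℤ.+ 1ℤ ℤ.≤ v → P v) →
             ∀ v → w ℤ.≤ v → P v
extendFrom Pw P-beyond v w≤v with i≤j⇒j≡i⊎i+1≤j w≤v
... | inj₁ refl = Pw
... | inj₂ w+1≤v = P-beyond v w+1≤v

EqualFrom : ℤ → GFS → GFS → Set
EqualFrom w f g = ∀ v → w ℤ.≤ v → f v ≡ g v

EqualBelow : ℤ → GFS → GFS → Set
EqualBelow w f g = ∀ v → v ℤ.< w → f v ≡ g v

VanishesFrom : ℤ → GFS → Set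
VanishesFrom w f = ∀ v → w ℤ.≤ v → f v ≡ 0

FiniteSupport : GFS → Set
FiniteSupport f = ∃ λ w → VanishesFrom w f

pairSum : GFS → ℤ → ℕ
pairSum f v = f v + f (v ℤ.+ 1ℤ)

PairsBounded : ℕ → ℤ → GFS → Set
PairsBounded h w f = ∀ v → w ℤ.≤ v → pairSum f v ≤ h

pairAhead : GFS → ℤ → ℕ
pairAhead f w = f (w ℤ.+ 1ℤ) + f (w ℤ.+ + 2)

pairAhead≡pairSum : ∀ f w → pairAhead f w ≡ pairSum f (w ℤ.+ 1ℤ)
pairAhead≡pairSum f w = cong (λ v → f (w ℤ.+ 1ℤ) + f v) (i+2≡i+1+1 w)
  where
  i+2≡i+1+1 : ∀ i → i ℤ.+ + 2 ≡ (i ℤ.+ 1ℤ) ℤ.+ 1ℤ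
  i+2≡i+1+1 = solve-∀

move-focus : ∀ f w → move f w w ≡ f w ∸ 1
move-focus f w with w ℤP.≟ w
... | yes _ = refl
... | no w≢w = ⊥-elim (w≢w refl)

move-next : ∀ f w → move f w (w ℤ.+ 1ℤ) ≡ suc (f (w ℤ.+ 1ℤ))
move-next f w with w ℤ.+ 1ℤ ℤP.≟ w
... | yes w+1≡w = ⊥-elim (ℤP.<-irrefl (sym w+1≡w) (i<i+1 w))
... | no _ with w ℤ.+ 1ℤ ℤP.≟ w ℤ.+ 1ℤ
...   | yes _ = refl
...   | no w+1≢w+1 = ⊥-elim (w+1≢w+1 refl)

move-other : ∀ f w {v} → v ≢ w → v ≢ w ℤ.+ 1ℤ → move f w v ≡ f v
move-other f w {v} v≢w v≢w+1 with v ℤP.≟ w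
... | yes v≡w = ⊥-elim (v≢w v≡w)
... | no _ with v ℤP.≟ w ℤ.+ 1ℤ
...   | yes v≡w+1 = ⊥-elim (v≢w+1 v≡w+1)
...   | no _ = refl

move-≤ : ∀ f w {v} → v ≢ w ℤ.+ 1ℤ → move f w v ≤ f v
move-≤ f w {v} v≢w+1 with v ℤP.≟ w
... | yes refl = ℕP.m∸n≤m (f v) 1
... | no _ with v ℤP.≟ w ℤ.+ 1ℤ
...   | yes v≡w+1 = ⊥-elim (v≢w+1 v≡w+1)
...   | no _ = ℕP.≤-refl

move-below : ∀ f {w v} → v ℤ.< w → move f w v ≡ f v
move-below f {w} v<w = move-other f w (ℤP.<⇒≢ v<w) (ℤP.<⇒≢ (ℤP.<-trans v<w (i<i+1 w)))

move-beyond : ∀ f {w v} → (w ℤ.+ 1ℤ) ℤ.+ 1ℤ ℤ.≤ v → move f w v ≡ f v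
move-beyond f {w} w+2≤v = move-other f w
  (ℤP.<⇒≢ (ℤP.<-≤-trans (ℤP.<-trans (i<i+1 w) (i<i+1 _)) w+2≤v) ∘ sym)
  (ℤP.<⇒≢ (ℤP.<-≤-trans (i<i+1 _) w+2≤v) ∘ sym)

move-cong : ∀ {w f f′} → EqualFrom w f f′ → EqualFrom w (move f w) (move f′ w)
move-cong {w} f≡f′ v w≤v with v ℤP.≟ w
... | yes refl = cong (_∸ 1) (f≡f′ v w≤v)
... | no _ with v ℤP.≟ w ℤ.+ 1ℤ
...   | yes refl = cong suc (f≡f′ v w≤v)
...   | no _ = f≡f′ v w≤v

pairAhead-cong : ∀ {w f f′} → EqualFrom w f f′ → pairAhead f w ≡ pairAhead f′ w
pairAhead-cong {w} f≡f′ = cong₂ _+_ (f≡f′ _ (i≤i+1 w)) (f≡f′ _ (ℤP.i≤i+j w (+ 2)))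

pairAhead-vanishes : ∀ {w₀ w f} → VanishesFrom w₀ f → w₀ ℤ.≤ w → pairAhead f w ≡ 0
pairAhead-vanishes {w = w} f≡0 w₀≤w =
  cong₂ _+_ (f≡0 _ (ℤP.≤-trans w₀≤w (i≤i+1 w)))
            (f≡0 _ (ℤP.≤-trans w₀≤w (ℤP.i≤i+j w (+ 2))))

move-vanishes : ∀ {w₀ f} w → VanishesFrom w₀ f →
                VanishesFrom (w₀ ℤ.⊔ ((w ℤ.+ 1ℤ) ℤ.+ 1ℤ)) (move f w)
move-vanishes {w₀} {f} w f≡0 v w₀⊔w+2≤v =
  trans (move-beyond f (ℤP.i⊔j≤k⇒j≤k w₀ _ w₀⊔w+2≤v))
        (f≡0 v (ℤP.i⊔j≤k⇒i≤k w₀ _ w₀⊔w+2≤v))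

move-preserves-bound : ∀ {h w w₀ f} → w₀ ℤ.≤ w → pairAhead f w < h →
                       PairsBounded h w₀ f → PairsBounded h w₀ (move f w)
move-preserves-bound {h} {w} {f = f} w₀≤w can bounded v w₀≤v with w ℤP.≟ v
... | yes refl = subst (_≤ h) (sym (cong₂ _+_ (move-focus f w) (move-next f w)))
                   (drain (f w) (subst (_< h) (pairAhead≡pairSum f w) can) (bounded w w₀≤w))
  where
  drain : ∀ a {b c} → b + c < h → a + b ≤ h → (a ∸ 1) + suc b ≤ h
  drain zero {b} {c} b+c<h _ = ℕP.≤-trans (s≤s (ℕP.m≤m+n b c)) b+c<h
  drain (suc a) {b} _ a+b≤h = subst (_≤ h) (sym (ℕP.+-suc a b)) a+b≤h
... | no w≢v with w ℤ.+ 1ℤ ℤP.≟ v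
...   | yes refl = subst (_≤ h) (sym (cong₂ _+_ (move-next f w) (move-beyond f {w} ℤP.≤-refl)))
                     (subst (_< h) (pairAhead≡pairSum f w) can)
...   | no w+1≢v = ℕP.≤-trans
                     (ℕP.+-mono-≤ (move-≤ f w (w+1≢v ∘ sym))
                                  (move-≤ f w (w≢v ∘ sym ∘ ∙-cancelʳ 1ℤ v w)))
                     (bounded v w₀≤v)

run-below : ∀ {h w m f g} → Run h w m f g → EqualBelow w g f
run-below done v v<w = refl
run-below {f = f} (motion _ run) v v<w = trans (run-below run v v<w) (move-below f v<w)
run-below {w = w} (shift _ run) v v<w = run-below run v (ℤP.<-trans v<w (i<i+1 w))

run-keeps-below : ∀ {h w w′ m f g f₀} → Run h w m f g → w ℤ.≤ w′ →
                  EqualBelow w′ f f₀ → EqualBelow w g f₀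
run-keeps-below run w≤w′ f≡f₀ v v<w = trans (run-below run v v<w) (f≡f₀ v (ℤP.<-≤-trans v<w w≤w′))

run-preserves-bound : ∀ {h w w₀ m f g} → Run h w m f g → w₀ ℤ.≤ w →
                      PairsBounded h w₀ f → PairsBounded h w₀ g
run-preserves-bound done _ bounded = bounded
run-preserves-bound (motion can run) w₀≤w bounded =
  run-preserves-bound run w₀≤w (move-preserves-bound w₀≤w can bounded)
run-preserves-bound {w = w} (shift _ run) w₀≤w bounded =
  run-preserves-bound run (ℤP.≤-trans w₀≤w (i≤i+1 w)) bounded

run-cong : ∀ {h w m f f′ g} → Run h w m f g → EqualFrom w f f′ →
           ∃ λ g′ → Run h w m f′ g′ × EqualFrom w g g′
run-cong done f≡f′ = _ , done , f≡f′
run-cong {h} (motion can run) f≡f′ =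
  let (g′ , run′ , g≡g′) = run-cong run (move-cong f≡f′)
  in g′ , motion (subst (_< h) (pairAhead-cong f≡f′) can) run′ , g≡g′
run-cong {h} {w} (shift cannot run) f≡f′ =
  let (g′ , run′ , g≡g′) = run-cong run (λ v w+1≤v → f≡f′ v (ℤP.≤-trans (i≤i+1 w) w+1≤v))
      g≡g′-at-w = trans (run-below run w (i<i+1 w))
                    (trans (f≡f′ w ℤP.≤-refl) (sym (run-below run′ w (i<i+1 w))))
  in g′ , shift (cannot ∘ subst (_< h) (sym (pairAhead-cong f≡f′))) run′ , extendFrom g≡g′-at-w g≡g′

run-exists : ∀ {h} → 0 < h → ∀ m w f → FiniteSupport f → ∃ λ g → Run h w m f g × FiniteSupport g
run-exists h>0 zero w f supp = f , done , supp
run-exists {h} h>0 (suc m) w f (w₀ , f≡0) =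
  let (d , w⊔w₀≡w+d) = i≤j⇒j≡i+d (ℤP.i≤i⊔j w w₀)
  in search d w (subst (w₀ ℤ.≤_) w⊔w₀≡w+d (ℤP.i≤j⊔i w w₀))
  where
  search : ∀ d w → w₀ ℤ.≤ w ℤ.+ + d → ∃ λ g → Run h w (suc m) f g × FiniteSupport g
  search d w w₀≤w+d with pairAhead f w <? h
  ... | yes can =
    let (g , run , supp) = run-exists h>0 m w (move f w) (_ , move-vanishes w f≡0)
    in g , motion can run , supp
  search zero w w₀≤w+0 | no cannot =
    ⊥-elim (cannot (subst (_< h) (sym (pairAhead-vanishes f≡0 w₀≤w)) h>0))
    where
    w₀≤w : w₀ ℤ.≤ w
    w₀≤w = subst (w₀ ℤ.≤_) (ℤP.+-identityʳ w) w₀≤w+0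
  search (suc d) w w₀≤w+d | no cannot =
    let (g , run , supp) =
          search d (w ℤ.+ 1ℤ) (subst (w₀ ℤ.≤_) (sym (ℤP.+-assoc w 1ℤ (+ d))) w₀≤w+d)
    in g , shift cannot run , supp

pm⇒run : ∀ {h w m f g} → pairSum f w ≡ h → PM w m f g → PairsBounded h w f × Run h w m f g
pm⇒run refl pm = pm

run⇒pm : ∀ {h w m f g} → pairSum f w ≡ h → PairsBounded h w f → Run h w m f g → PM w m f g
run⇒pm refl bounded run = bounded , run

-- The j motions at w carry the j particles of w to w′ one at a time (w′ + 1 is
-- empty); then w′ holds h particles, so the focus shifts to w′, where f agrees
-- with f′ from w′ on.
run-fill-then-follow : ∀ {h w w′ p f′ g′} → w ℤ.+ 1ℤ ≡ w′ → ∀ j f →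
  f w ≡ j → f w′ + j ≡ h → f′ w′ ≡ h → f′ (w′ ℤ.+ 1ℤ) ≡ 0 →
  EqualFrom (w′ ℤ.+ 1ℤ) f f′ →
  Run h w′ p f′ g′ →
  ∃ λ g → Run h w (j + p) f g × g w ≡ 0 × EqualFrom w′ g g′
run-fill-then-follow {h} {w} {f′ = f′} refl zero f fw≡0 fw′+0≡h f′w′≡h _ f≡f′ = follow
  where
  w′ : ℤ
  w′ = w ℤ.+ 1ℤ
  fw′≡h : f w′ ≡ h
  fw′≡h = trans (sym (ℕP.+-identityʳ _)) fw′+0≡h
  f′≡f : EqualFrom w′ f′ f
  f′≡f = extendFrom (trans f′w′≡h (sym fw′≡h)) (λ v q → sym (f≡f′ v q))
  cannot : ¬ (pairAhead f w < h)
  cannot = ℕP.m+n≮m h _ ∘ subst (λ a → a + f (w ℤ.+ + 2) < h) fw′≡h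
  follow : ∀ {p g′} → Run h w′ p f′ g′ →
           ∃ λ g → Run h w p f g × g w ≡ 0 × EqualFrom w′ g g′
  follow {zero} done = f , done , fw≡0 , λ v q → sym (f′≡f v q)
  follow {suc p} run′ =
    let (g , run , g′≡g) = run-cong run′ f′≡f
    in g , shift cannot run , trans (run-below run w (i<i+1 w)) fw≡0 , λ v q → sym (g′≡g v q)
run-fill-then-follow {h} {w} {f′ = f′} refl (suc j) f
                     fw≡1+j fw′+1+j≡h f′w′≡h f′w′+1≡0 f≡f′ run′ =
  let (g , run , gw≡0 , g≡g′) =
        run-fill-then-follow refl j (move f w) moved-focus moved-next f′w′≡h f′w′+1≡0 moved≡f′ run′
  in g , motion can run , gw≡0 , g≡g′
  where
  open ℕP.≤-Reasoning
  w′ : ℤ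
  w′ = w ℤ.+ 1ℤ
  can : pairAhead f w < h
  can = subst (_< h) (sym (pairAhead≡pairSum f w)) (begin-strict
    f w′ + f (w′ ℤ.+ 1ℤ)   ≡⟨ cong (λ x → f w′ + x) (trans (f≡f′ _ ℤP.≤-refl) f′w′+1≡0) ⟩
    f w′ + 0               <⟨ ℕP.+-monoʳ-< (f w′) (s≤s z≤n) ⟩
    f w′ + suc j           ≡⟨ fw′+1+j≡h ⟩
    h                      ∎)
  moved-focus : move f w w ≡ j
  moved-focus = trans (move-focus f w) (cong (_∸ 1) fw≡1+j)
  moved-next : move f w w′ + j ≡ h
  moved-next = trans (cong (_+ j) (move-next f w)) (trans (sym (ℕP.+-suc _ j)) fw′+1+j≡h)
  moved≡f′ : EqualFrom (w′ ℤ.+ 1ℤ) (move f w) f′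
  moved≡f′ v w′+1≤v = trans (move-beyond f w′+1≤v) (f≡f′ v w′+1≤v)

pm-fill-then-follow : ∀ {h w w′ p f f′ g′} → w ℤ.+ 1ℤ ≡ w′ →
  f w ≡ h → f w′ ≡ 0 → f′ w′ ≡ h → f′ (w′ ℤ.+ 1ℤ) ≡ 0 →
  EqualFrom (w′ ℤ.+ 1ℤ) f f′ →
  PM w′ p f′ g′ →
  ∃ λ g → PM w (h + p) f g × g w ≡ 0 × EqualFrom w′ g g′
pm-fill-then-follow {h} {w} {f = f} {f′} refl fw≡h fw′≡0 f′w′≡h f′w′+1≡0 f≡f′ pm′ =
  let (bounded′ , run′) = pm⇒run (pairSum≡h f′ w′ f′w′≡h f′w′+1≡0) pm′
      (g , run , gw≡0 , g≡g′) =
        run-fill-then-follow refl h f fw≡h (cong (_+ h) fw′≡0) f′w′≡h f′w′+1≡0 f≡f′ run′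
  in g , run⇒pm (pairSum≡h f w fw≡h fw′≡0) (bounded bounded′) run , gw≡0 , g≡g′
  where
  w′ : ℤ
  w′ = w ℤ.+ 1ℤ
  pairSum≡h : ∀ {a} k v → k v ≡ a → k (v ℤ.+ 1ℤ) ≡ 0 → pairSum k v ≡ a
  pairSum≡h {a} k v kv≡a kv+1≡0 = trans (cong₂ _+_ kv≡a kv+1≡0) (ℕP.+-identityʳ a)
  bounded : PairsBounded h w′ f′ → PairsBounded h w f
  bounded bounded′ = extendFrom (ℕP.≤-reflexive (pairSum≡h f w fw≡h fw′≡0)) (extendFrom
    (subst (_≤ h) (sym (trans (cong₂ _+_ fw′≡0 (f≡f′ _ ℤP.≤-refl)) f′w′+1≡0)) z≤n)
    (λ v q → subst (_≤ h) (cong₂ _+_ (sym (f≡f′ v q)) (sym (f≡f′ _ (ℤP.≤-trans q (i≤i+1 v)))))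
                   (bounded′ v (ℤP.≤-trans (i≤i+1 w′) q))))

partCount : ∀ {k} → Vec (List ℕ) k → ℕ
partCount [] = 0
partCount (x ∷ xs) = length x + partCount xs

length-allParts : ∀ {k} (ls : Vec (List ℕ) k) → length (allParts ls) ≡ partCount ls
length-allParts [] = refl
length-allParts (x ∷ xs) = trans (ListP.length-++ x) (cong (λ n → length x + n) (length-allParts xs))

suffixLens-cons : ∀ {k} x (xs : Vec (List ℕ) k) →
                  suffixLens (x ∷ xs) ≡ partCount (x ∷ xs) ∷ suffixLens xs
suffixLens-cons x [] = cong (_∷ []) (sym (ℕP.+-identityʳ (length x)))
suffixLens-cons x (y ∷ ys) rewrite suffixLens-cons y ys = refl

partCount-plusFrom : ∀ {k} m (ls : Vec (List ℕ) k) → partCount (plusFrom m ls) ≡ partCount ls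
partCount-plusFrom m [] = refl
partCount-plusFrom m (x ∷ xs) = cong₂ _+_ (ListP.length-map _ x) (partCount-plusFrom (suc m) xs)

suffixLens-plusFrom : ∀ {k} m (ls : Vec (List ℕ) k) → suffixLens (plusFrom m ls) ≡ suffixLens ls
suffixLens-plusFrom m [] = refl
suffixLens-plusFrom m (x ∷ xs) = begin
  suffixLens (plusFrom m (x ∷ xs))                                ≡⟨ suffixLens-cons _ (plusFrom (suc m) xs) ⟩
  partCount (plusFrom m (x ∷ xs)) ∷ suffixLens (plusFrom (suc m) xs)
    ≡⟨ cong₂ _∷_ (partCount-plusFrom m (x ∷ xs)) (suffixLens-plusFrom (suc m) xs) ⟩
  partCount (x ∷ xs) ∷ suffixLens xs                              ≡⟨ suffixLens-cons x xs ⟨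
  suffixLens (x ∷ xs)                                             ∎
  where open ≡-Reasoning

frameHeight : ∀ {k} → Vec (List ℕ) k → ℕ → ℕ
frameHeight ls t = countAbove t (suffixLens ls)

frameHeight-cons : ∀ {k} x (xs : Vec (List ℕ) k) {t} → t < partCount (x ∷ xs) →
                   frameHeight (x ∷ xs) t ≡ suc (frameHeight xs t)
frameHeight-cons x xs {t} t<ℓ =
  trans (cong (countAbove t) (suffixLens-cons x xs)) (cong length (ListP.filter-accept (t <?_) t<ℓ))

frameHeight-vanishes : ∀ {k} (ls : Vec (List ℕ) k) {t} → partCount ls ≤ t → frameHeight ls t ≡ 0
frameHeight-vanishes [] _ = refl
frameHeight-vanishes (x ∷ xs) {t} ℓ≤t =
  trans (cong (countAbove t) (suffixLens-cons x xs))
    (trans (cong length (ListP.filter-reject (t <?_) (ℕP.≤⇒≯ ℓ≤t)))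
      (frameHeight-vanishes xs (ℕP.≤-trans (ℕP.m≤n+m _ (length x)) ℓ≤t)))

frameHeight-positive : ∀ {k} (ls : Vec (List ℕ) k) {t} → t < partCount ls → 0 < frameHeight ls t
frameHeight-positive (x ∷ xs) t<ℓ = subst (0 <_) (sym (frameHeight-cons x xs t<ℓ)) (s≤s z≤n)

frameHeight-antitone : ∀ {k} (ls : Vec (List ℕ) k) {t t′} → t ≤ t′ →
                       frameHeight ls t′ ≤ frameHeight ls t
frameHeight-antitone ls {t} {t′} t≤t′ = SublistH.length-mono-≤
  (SublistP.filter⁺ (t′ <?_) (t <?_) (λ { refl t′<s → ℕP.≤-<-trans t≤t′ t′<s })
                    (⊆-refl {x = suffixLens ls}))

-- As in LamRun, the parts of a list are indexed from its end: raiseBy c adds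
-- c t to λ_t, the part followed by t others.
raiseBy : (ℕ → ℕ) → List ℕ → List ℕ
raiseBy c [] = []
raiseBy c (p ∷ ps) = c (length ps) + p ∷ raiseBy c ps

length-raiseBy : ∀ c ps → length (raiseBy c ps) ≡ length ps
length-raiseBy c [] = refl
length-raiseBy c (p ∷ ps) = cong suc (length-raiseBy c ps)

raiseBy-cong : ∀ {c c′} ps → (∀ t → t < length ps → c t ≡ c′ t) → raiseBy c ps ≡ raiseBy c′ ps
raiseBy-cong [] _ = refl
raiseBy-cong (p ∷ ps) c≡c′ =
  cong₂ _∷_ (cong (_+ p) (c≡c′ _ ℕP.≤-refl))
            (raiseBy-cong ps (λ t t< → c≡c′ t (ℕP.m<n⇒m<1+n t<)))

raiseBy-++ : ∀ {c d} xs ys → (∀ t → length ys ≤ t → t < length xs + length ys → c t ≡ d) →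
             raiseBy c (xs ++ ys) ≡ map (λ p → d + p) xs ++ raiseBy c ys
raiseBy-++ [] ys _ = refl
raiseBy-++ {c} (x ∷ xs) ys c≡d = cong₂ _∷_
  (cong (_+ x) (trans (cong c (ListP.length-++ xs))
                      (c≡d _ (ℕP.m≤n+m _ (length xs)) ℕP.≤-refl)))
  (raiseBy-++ xs ys (λ t ys≤t t< → c≡d t ys≤t (ℕP.m<n⇒m<1+n t<)))

allParts-plusFrom : ∀ {k} m (ls : Vec (List ℕ) k) →
                    allParts (plusFrom (suc m) ls) ≡ raiseBy (λ t → m + frameHeight ls t) (allParts ls)
allParts-plusFrom m [] = refl
allParts-plusFrom m (x ∷ xs) = begin
  map (λ p → suc m + p) x ++ allParts (plusFrom (suc (suc m)) xs)
    ≡⟨ cong (map (λ p → suc m + p) x ++_) (allParts-plusFrom (suc m) xs) ⟩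
  map (λ p → suc m + p) x ++ raiseBy (λ t → suc m + frameHeight xs t) (allParts xs)
    ≡⟨ cong (map (λ p → suc m + p) x ++_) (raiseBy-cong (allParts xs) below-x) ⟩
  map (λ p → suc m + p) x ++ raiseBy (λ t → m + frameHeight (x ∷ xs) t) (allParts xs)
    ≡⟨ raiseBy-++ x (allParts xs) within-x ⟨
  raiseBy (λ t → m + frameHeight (x ∷ xs) t) (x ++ allParts xs)
    ∎
  where
  open ≡-Reasoning
  below-x : ∀ t → t < length (allParts xs) → suc m + frameHeight xs t ≡ m + frameHeight (x ∷ xs) t
  below-x t t< = trans (sym (ℕP.+-suc m _)) (cong (λ n → m + n) (sym (frameHeight-cons x xs
    (ℕP.<-≤-trans (subst (t <_) (length-allParts xs) t<) (ℕP.m≤n+m _ (length x))))))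
  within-x : ∀ t → length (allParts xs) ≤ t → t < length x + length (allParts xs) →
             m + frameHeight (x ∷ xs) t ≡ suc m
  within-x t ℓ≤t t< = trans
    (cong (λ n → m + n) (trans (frameHeight-cons x xs (subst (λ n → t < length x + n) (length-allParts xs) t<))
                        (cong suc (frameHeight-vanishes xs (subst (_≤ t) (length-allParts xs) ℓ≤t)))))
    (ℕP.+-comm m 1)

evenHalf-even : ∀ t → evenHalf (2 * t) ≡ just t
evenHalf-even zero = refl
evenHalf-even (suc t) = trans (cong evenHalf (ℕP.*-suc 2 t)) (cong (Maybe.map suc) (evenHalf-even t))

evenHalf-odd : ∀ t → evenHalf (suc (2 * t)) ≡ nothing
evenHalf-odd zero = refl
evenHalf-odd (suc t) = trans (cong (evenHalf ∘ suc) (ℕP.*-suc 2 t)) (cong (Maybe.map suc) (evenHalf-odd t))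

data Halving : ℕ → Set where
  even : ∀ t → Halving (2 * t)
  odd  : ∀ t → Halving (suc (2 * t))

halving : ∀ n → Halving n
halving zero = even 0
halving (suc n) with halving n
... | even t = odd t
... | odd t = subst Halving (ℕP.*-suc 2 t) (even (suc t))

frameAtOffset : List ℕ → ℤ → ℕ
frameAtOffset ss -[1+ _ ] = 0
frameAtOffset ss (+ n) = maybe′ (λ t → countAbove t ss) 0 (evenHalf n)

fs≡frameAtOffset : ∀ {k} u (ls : Vec (List ℕ) k) i → fs u ls i ≡ frameAtOffset (suffixLens ls) (i - u)
fs≡frameAtOffset u ls i with i - u
... | -[1+ _ ] = refl
... | + n with evenHalf n
...   | nothing = refl
...   | just _ = refl

module _ {k} (u : ℤ) (ls : Vec (List ℕ) k) where

  fs-offset : ∀ n → fs u ls (u ℤ.+ + n) ≡ maybe′ (frameHeight ls) 0 (evenHalf n)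
  fs-offset n = trans (fs≡frameAtOffset u ls (u ℤ.+ + n))
                      (cong (frameAtOffset (suffixLens ls)) (u+i-u≡i u (+ n)))
    where
    u+i-u≡i : ∀ u i → (u ℤ.+ i) - u ≡ i
    u+i-u≡i = solve-∀

  fs-even : ∀ t → fs u ls (u ℤ.+ + (2 * t)) ≡ frameHeight ls t
  fs-even t = trans (fs-offset (2 * t)) (cong (maybe′ (frameHeight ls) 0) (evenHalf-even t))

  fs-odd : ∀ t → fs u ls ((u ℤ.+ + (2 * t)) ℤ.+ 1ℤ) ≡ 0
  fs-odd t = begin
    fs u ls ((u ℤ.+ + (2 * t)) ℤ.+ 1ℤ)  ≡⟨ cong (fs u ls) (ℤP.+-assoc u (+ (2 * t)) 1ℤ) ⟩
    fs u ls (u ℤ.+ + (2 * t + 1))      ≡⟨ cong (λ n → fs u ls (u ℤ.+ + n)) (ℕP.+-comm (2 * t) 1) ⟩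
    fs u ls (u ℤ.+ + suc (2 * t))      ≡⟨ fs-offset (suc (2 * t)) ⟩
    maybe′ (frameHeight ls) 0 (evenHalf (suc (2 * t)))
                                       ≡⟨ cong (maybe′ (frameHeight ls) 0) (evenHalf-odd t) ⟩
    0                                  ∎
    where open ≡-Reasoning

  fs-below : ∀ {v} → v ℤ.< u → fs u ls v ≡ 0
  fs-below {v} v<u = trans (fs≡frameAtOffset u ls v) (negative (v - u) v-u<0)
    where
    v-u<0 : v - u ℤ.< + 0
    v-u<0 = subst (v - u ℤ.<_) (ℤP.+-inverseʳ u) (ℤP.+-monoˡ-< (ℤ.- u) v<u)
    negative : ∀ {ss} i → i ℤ.< + 0 → frameAtOffset ss i ≡ 0
    negative -[1+ _ ] _ = refl
    negative (+ _) (ℤ.+<+ ())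

  fs-shift : ∀ {k′} (ls′ : Vec (List ℕ) k′) → suffixLens ls′ ≡ suffixLens ls →
             ∀ v → fs (u - 1ℤ) ls′ v ≡ fs u ls (v ℤ.+ 1ℤ)
  fs-shift ls′ same v = begin
    fs (u - 1ℤ) ls′ v                                    ≡⟨ fs≡frameAtOffset (u - 1ℤ) ls′ v ⟩
    frameAtOffset (suffixLens ls′) (v - (u - 1ℤ))        ≡⟨ cong₂ frameAtOffset same (shift-offset v u) ⟩
    frameAtOffset (suffixLens ls) ((v ℤ.+ 1ℤ) - u)       ≡⟨ fs≡frameAtOffset u ls (v ℤ.+ 1ℤ) ⟨
    fs u ls (v ℤ.+ 1ℤ)                                   ∎
    where
    open ≡-Reasoning
    shift-offset : ∀ v u → v - (u - 1ℤ) ≡ (v ℤ.+ 1ℤ) - u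
    shift-offset = solve-∀

module Frames {k} (u : ℤ) (ls : Vec (List ℕ) k) where

  ℓ : ℕ
  ℓ = partCount ls

  height : ℕ → ℕ
  height = frameHeight ls

  frame frame⁺ : GFS
  frame = fs u ls
  frame⁺ = fs (u - 1ℤ) (plus ls)

  site site⁺ : ℕ → ℤ
  site n = u ℤ.+ + (2 * n)
  site⁺ n = (u - 1ℤ) ℤ.+ + (2 * n)

  site⁺+1≡site : ∀ n → site⁺ n ℤ.+ 1ℤ ≡ site n
  site⁺+1≡site n = [u-1+x]+1≡u+x u (+ (2 * n))
    where
    [u-1+x]+1≡u+x : ∀ u x → ((u - 1ℤ) ℤ.+ x) ℤ.+ 1ℤ ≡ u ℤ.+ x
    [u-1+x]+1≡u+x = solve-∀

  two-further : ∀ w n → w ℤ.+ + (2 * suc n) ≡ ((w ℤ.+ + (2 * n)) ℤ.+ 1ℤ) ℤ.+ 1ℤ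
  two-further w n = trans (cong (λ m → w ℤ.+ + m) (ℕP.*-suc 2 n)) (regroup w (+ (2 * n)))
    where
    regroup : ∀ w x → w ℤ.+ ((1ℤ ℤ.+ 1ℤ) ℤ.+ x) ≡ ((w ℤ.+ x) ℤ.+ 1ℤ) ℤ.+ 1ℤ
    regroup = solve-∀

  site-suc : ∀ n → site (suc n) ≡ (site n ℤ.+ 1ℤ) ℤ.+ 1ℤ
  site-suc = two-further u

  site⁺-suc : ∀ n → site⁺ (suc n) ≡ site n ℤ.+ 1ℤ
  site⁺-suc n = trans (two-further (u - 1ℤ) n) (cong (ℤ._+ 1ℤ) (site⁺+1≡site n))

  site⁺<site : ∀ n → site⁺ n ℤ.< site n
  site⁺<site n = subst (site⁺ n ℤ.<_) (site⁺+1≡site n) (i<i+1 _)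

  site<site⁺-suc : ∀ n → site n ℤ.< site⁺ (suc n)
  site<site⁺-suc n = subst (site n ℤ.<_) (sym (site⁺-suc n)) (i<i+1 _)

  site+1<site-suc : ∀ n → site n ℤ.+ 1ℤ ℤ.< site (suc n)
  site+1<site-suc n = subst (site n ℤ.+ 1ℤ ℤ.<_) (sym (site-suc n)) (i<i+1 _)

  site<site-suc : ∀ n → site n ℤ.< site (suc n)
  site<site-suc n = ℤP.<-trans (i<i+1 _) (site+1<site-suc n)

  site⁺<site⁺-suc : ∀ n → site⁺ n ℤ.< site⁺ (suc n)
  site⁺<site⁺-suc n = ℤP.<-trans (site⁺<site n) (site<site⁺-suc n)

  site-+ : ∀ n t → site n ℤ.+ + (2 * t) ≡ site (n + t)
  site-+ n t = trans (ℤP.+-assoc u (+ (2 * n)) (+ (2 * t)))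
                     (cong (λ m → u ℤ.+ + m) (sym (ℕP.*-distribˡ-+ 2 n t)))

  beyond-site : ∀ {n v} → site n ℤ.≤ v → ∃ λ t → v ≡ site (n + t) ⊎ v ≡ site (n + t) ℤ.+ 1ℤ
  beyond-site {n} site≤v with i≤j⇒j≡i+d site≤v
  ... | d , refl with halving d
  ...   | even t = t , inj₁ (site-+ n t)
  ...   | odd t = t , inj₂ (trans (i+[1+j]≡[i+j]+1 (site n) (+ (2 * t))) (cong (ℤ._+ 1ℤ) (site-+ n t)))
    where
    i+[1+j]≡[i+j]+1 : ∀ i j → i ℤ.+ (1ℤ ℤ.+ j) ≡ (i ℤ.+ j) ℤ.+ 1ℤ
    i+[1+j]≡[i+j]+1 = solve-∀

  frame⁺≡frame∘suc : ∀ v → frame⁺ v ≡ frame (v ℤ.+ 1ℤ)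
  frame⁺≡frame∘suc = fs-shift u ls (plus ls) (suffixLens-plusFrom 1 ls)

  frame-site : ∀ n → frame (site n) ≡ height n
  frame-site = fs-even u ls

  frame-site+1 : ∀ n → frame (site n ℤ.+ 1ℤ) ≡ 0
  frame-site+1 = fs-odd u ls

  frame-below : ∀ {v} → v ℤ.< site 0 → frame v ≡ 0
  frame-below {v} v<site = fs-below u ls (subst (v ℤ.<_) (ℤP.+-identityʳ u) v<site)

  frame-site⁺ : ∀ n → frame (site⁺ n) ≡ 0
  frame-site⁺ zero = frame-below (site⁺<site 0)
  frame-site⁺ (suc n) = trans (cong frame (site⁺-suc n)) (frame-site+1 n)

  frame-vanishes : VanishesFrom (site ℓ) frame
  frame-vanishes v site≤v with beyond-site {ℓ} site≤v
  ... | t , inj₁ refl = trans (frame-site (ℓ + t)) (frameHeight-vanishes ls (ℕP.m≤m+n ℓ t))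
  ... | t , inj₂ refl = frame-site+1 (ℓ + t)

  frame-bounded : ∀ n → PairsBounded (height n) (site n) frame
  frame-bounded n v site≤v with beyond-site {n} site≤v
  ... | t , inj₁ refl = begin
    frame (site (n + t)) + frame (site (n + t) ℤ.+ 1ℤ)
      ≡⟨ cong₂ _+_ (frame-site (n + t)) (frame-site+1 (n + t)) ⟩
    height (n + t) + 0                                   ≡⟨ ℕP.+-identityʳ _ ⟩
    height (n + t)                                       ≤⟨ frameHeight-antitone ls (ℕP.m≤m+n n t) ⟩
    height n                                             ∎
    where open ℕP.≤-Reasoning
  ... | t , inj₂ refl = begin
    frame (site (n + t) ℤ.+ 1ℤ) + frame ((site (n + t) ℤ.+ 1ℤ) ℤ.+ 1ℤ)
      ≡⟨ cong₂ _+_ (frame-site+1 (n + t))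
                   (trans (cong frame (sym (site-suc (n + t)))) (frame-site (suc (n + t)))) ⟩
    height (suc (n + t))   ≤⟨ frameHeight-antitone ls (ℕP.m≤n⇒m≤1+n (ℕP.m≤m+n n t)) ⟩
    height n               ∎
    where open ℕP.≤-Reasoning

  frame⁺-vanishes : VanishesFrom (site⁺ ℓ) frame⁺
  frame⁺-vanishes v site⁺≤v = trans (frame⁺≡frame∘suc v)
    (frame-vanishes _ (subst (ℤ._≤ v ℤ.+ 1ℤ) (site⁺+1≡site ℓ) (ℤP.+-monoˡ-≤ 1ℤ site⁺≤v)))

  -- Both sides once the parts λ_{ℓ-1}, …, λ_n have been processed: f by the
  -- runs at the sites u + 2t, f⁺ by those at u - 1 + 2t, for t ≥ n.
  record Stage (n : ℕ) (f⁺ f : GFS) : Set where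
    field
      untouched  : EqualBelow (site n) f frame
      bounded    : PairsBounded (height n) (site n) f
      finite     : FiniteSupport f
      untouched⁺ : EqualBelow (site⁺ n) f⁺ frame⁺
      follows⁺   : EqualFrom (site⁺ n) f⁺ f

  stage-initial : Stage ℓ frame⁺ frame
  stage-initial = record
    { untouched  = λ _ _ → refl
    ; bounded    = frame-bounded ℓ
    ; finite     = site ℓ , frame-vanishes
    ; untouched⁺ = λ _ _ → refl
    ; follows⁺   = λ v site⁺≤v →
        trans (frame⁺-vanishes v site⁺≤v) (sym (frame-vanishes-from-site⁺ v site⁺≤v))
    }
    where
    frame-vanishes-from-site⁺ : VanishesFrom (site⁺ ℓ) frame
    frame-vanishes-from-site⁺ = extendFrom (frame-site⁺ ℓ)
      (λ v q → frame-vanishes v (subst (ℤ._≤ v) (site⁺+1≡site ℓ) q))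

  stage-final : ∀ {f⁺ f} → Stage 0 f⁺ f → f⁺ ≗ f
  stage-final {f⁺} {f} stage v with v ℤP.<? site⁺ 0
  ... | no v≮site⁺ = follows⁺ v (ℤP.≮⇒≥ v≮site⁺)
    where open Stage stage
  ... | yes v<site⁺ = begin
    f⁺ v               ≡⟨ untouched⁺ v v<site⁺ ⟩
    frame⁺ v           ≡⟨ frame⁺≡frame∘suc v ⟩
    frame (v ℤ.+ 1ℤ)   ≡⟨ frame-below (subst (v ℤ.+ 1ℤ ℤ.<_) (site⁺+1≡site 0)
                                             (ℤP.+-monoˡ-< 1ℤ v<site⁺)) ⟩
    0                  ≡⟨ frame-below (ℤP.<-trans v<site⁺ (site⁺<site 0)) ⟨
    frame v            ≡⟨ untouched v (ℤP.<-trans v<site⁺ (site⁺<site 0)) ⟨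
    f v                ∎
    where
    open Stage stage
    open ≡-Reasoning

  module _ {n f⁺ f} (stage : Stage (suc n) f⁺ f) where
    open Stage stage

    f-site : f (site n) ≡ height n
    f-site = trans (untouched _ (site<site-suc n)) (frame-site n)

    f-site+1 : f (site n ℤ.+ 1ℤ) ≡ 0
    f-site+1 = trans (untouched _ (site+1<site-suc n)) (frame-site+1 n)

    f⁺-site⁺ : f⁺ (site⁺ n) ≡ height n
    f⁺-site⁺ = trans (untouched⁺ _ (site⁺<site⁺-suc n))
      (trans (frame⁺≡frame∘suc (site⁺ n)) (trans (cong frame (site⁺+1≡site n)) (frame-site n)))

    f⁺-site : f⁺ (site n) ≡ 0
    f⁺-site = trans (untouched⁺ _ (site<site⁺-suc n)) (trans (frame⁺≡frame∘suc (site n)) (frame-site+1 n))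

    f⁺≡f : EqualFrom (site n ℤ.+ 1ℤ) f⁺ f
    f⁺≡f v q = follows⁺ v (subst (ℤ._≤ v) (sym (site⁺-suc n)) q)

    pairSum-site : pairSum f (site n) ≡ height n
    pairSum-site = trans (cong₂ _+_ f-site f-site+1) (ℕP.+-identityʳ _)

    bounded-from-site : PairsBounded (height n) (site n) f
    bounded-from-site = extendFrom (ℕP.≤-reflexive pairSum-site) (extendFrom at-site+1 beyond)
      where
      open ℕP.≤-Reasoning
      lower : height (suc n) ≤ height n
      lower = frameHeight-antitone ls (ℕP.n≤1+n n)
      at-site+1 : pairSum f (site n ℤ.+ 1ℤ) ≤ height n
      at-site+1 = begin
        f (site n ℤ.+ 1ℤ) + f ((site n ℤ.+ 1ℤ) ℤ.+ 1ℤ)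
          ≡⟨ cong₂ _+_ f-site+1 (cong f (sym (site-suc n))) ⟩
        f (site (suc n))                                  ≤⟨ ℕP.m≤m+n _ _ ⟩
        pairSum f (site (suc n))                          ≤⟨ bounded _ ℤP.≤-refl ⟩
        height (suc n)                                    ≤⟨ lower ⟩
        height n                                          ∎
      beyond : PairsBounded (height n) ((site n ℤ.+ 1ℤ) ℤ.+ 1ℤ) f
      beyond v q = ℕP.≤-trans (bounded v (subst (ℤ._≤ v) (sym (site-suc n)) q)) lower

    stage-step : n < ℓ → ∀ p →
                 ∃₂ λ g⁺ g → PM (site⁺ n) (height n + p) f⁺ g⁺ × PM (site n) p f g × Stage n g⁺ g
    stage-step n<ℓ p =
      let (g , run , finite-g) = run-exists (frameHeight-positive ls n<ℓ) p (site n) f finite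
          pm : PM (site n) p f g
          pm = run⇒pm pairSum-site bounded-from-site run
          (g⁺ , pm⁺ , g⁺-site⁺ , g⁺≡g) =
            pm-fill-then-follow (site⁺+1≡site n) f⁺-site⁺ f⁺-site f-site f-site+1 f⁺≡f pm
          g-untouched : EqualBelow (site n) g frame
          g-untouched = run-keeps-below run (ℤP.<⇒≤ (site<site-suc n)) untouched
          g-site⁺ : g (site⁺ n) ≡ 0
          g-site⁺ = trans (g-untouched _ (site⁺<site n)) (frame-site⁺ n)
      in g⁺ , g , pm⁺ , pm , record
        { untouched  = g-untouched
        ; bounded    = run-preserves-bound run ℤP.≤-refl bounded-from-site
        ; finite     = finite-g
        ; untouched⁺ = run-keeps-below (proj₂ pm⁺) (ℤP.<⇒≤ (site⁺<site⁺-suc n)) untouched⁺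
        ; follows⁺   = extendFrom (trans g⁺-site⁺ (sym g-site⁺))
                         (λ v q → g⁺≡g v (subst (ℤ._≤ v) (site⁺+1≡site n) q))
        }

  Λ-runs : ∀ ps {f⁺ f} → length ps ≤ ℓ → Stage (length ps) f⁺ f →
           ∃₂ λ g⁺ g → LamRun (u - 1ℤ) (raiseBy height ps) f⁺ g⁺ × LamRun u ps f g × g⁺ ≗ g
  Λ-runs [] _ stage = _ , _ , nil , nil , stage-final stage
  Λ-runs (p ∷ ps) {f⁺} ps<ℓ stage =
    let (g⁺ , g , pm⁺ , pm , stage′) = stage-step stage ps<ℓ p
        (h⁺ , h , runs⁺ , runs , h⁺≗h) = Λ-runs ps (ℕP.<⇒≤ ps<ℓ) stage′
        pm⁺′ : PM (site⁺ (length (raiseBy height ps))) (height (length ps) + p) f⁺ g⁺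
        pm⁺′ = subst (λ m → PM (site⁺ m) (height (length ps) + p) f⁺ g⁺)
                     (sym (length-raiseBy height ps)) pm⁺
    in h⁺ , h , cons pm⁺′ runs⁺ , cons pm runs , h⁺≗h

proposition2p7 : (k : ℕ) → 1 ≤ k → (ls : Vec (List ℕ) k) → All NonIncreasing ls →
    (u : ℤ) →
    Σ GFS (λ g₁ → Σ GFS (λ g₂ →
      LambdaRel (u - 1ℤ) (plus ls) g₁ × LambdaRel u ls g₂ × ((i : ℤ) → g₁ i ≡ g₂ i)))
proposition2p7 _ _ ls _ u =
  let open Frames u ls
      (g⁺ , g , runs⁺ , runs , g⁺≗g) = Λ-runs (allParts ls) (ℕP.≤-reflexive (length-allParts ls))
        (subst (λ n → Stage n frame⁺ frame) (sym (length-allParts ls)) stage-initial)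
      runs⁺′ : LambdaRel (u - 1ℤ) (plus ls) g⁺
      runs⁺′ = subst (λ qs → LamRun (u - 1ℤ) qs frame⁺ g⁺) (sym (allParts-plusFrom 0 ls)) runs⁺
  in g⁺ , g , runs⁺′ , runs , g⁺≗g
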